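{- Let $H=(V_H,E_H)$ be a graph with $V_H=\{v_1,\dots,v_n\}$, and let $G$ be the GP graph obtained from $H$ by adding, for each $i$, new vertices $x_i,y_i,z_i$ and the path $v_i,x_i,y_i,z_i$. Then $\gamma_r(G)=2n$, and $V_H\cup\{z_i: 1\le i\le n\}$ is a restrained dominating set of $G$.
   Context: All graphs are finite and simple. A set $D\subseteq V$ of a graph $G=(V,E)$ is a restrained dominating set if every vertex in $V\setminus D$ is adjacent to some vertex in $D$ and to some vertex in $V\setminus D$. $\gamma_r(G)$ denotes the minimum cardinality of a restrained dominating set of $G$. A GP graph built from $H=(V_H,E_H)$, $V_H=\{v_1,\dots,v_n\}$, has vertex set $V_H\cup\{x_i,y_i,z_i:1\le i\le n\}$ and edge set $E_H\cup\{v_ix_i,x_iy_i,y_iz_i:1\le i\le n\}$. -}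

module Defs where

open import Data.Nat using (ℕ; zero; suc; _+_; _≤_)
open import Data.Bool using (Bool; true; false; if_then_else_)
open import Data.Fin using (Fin)
open import Data.List using (List; []; _∷_; map; _++_; allFin)
open import Data.Empty using (⊥)
open import Data.Product using (Σ; _×_; _,_; ∃-syntax)
open import Relation.Binary.PropositionalEquality using (_≡_)

-- Generic notions for a graph given by a vertex type V, an adjacency
-- relation Adj, and (for cardinalities) a duplicate-free complete list
-- of its vertices.

count : {V : Set} → (V → Bool) → List V → ℕ
count D []       = 0
count D (u ∷ us) = (if D u then 1 else 0) + count D us

RestrainedDominating : {V : Set} → (V → V → Set) → (V → Bool) → Set
RestrainedDominating {V} Adj D =
  (u : V) → D u ≡ false →
    (∃[ w ] (Adj u w × D w ≡ true)) × (∃[ w ] (Adj u w × D w ≡ false))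

IsRestrainedDomNumber : {V : Set} → (V → V → Set) → List V → ℕ → Set
IsRestrainedDomNumber {V} Adj vs k =
  (∃[ D ] (RestrainedDominating Adj D × count D vs ≡ k)) ×
  ((D : V → Bool) → RestrainedDominating Adj D → k ≤ count D vs)

Symmetric : {n : ℕ} → (Fin n → Fin n → Set) → Set
Symmetric {n} E = (i j : Fin n) → E i j → E j i

Irreflexive : {n : ℕ} → (Fin n → Fin n → Set) → Set
Irreflexive {n} E = (i : Fin n) → E i i → ⊥

data GPVertex (n : ℕ) : Set where
  v x y z : Fin n → GPVertex n

data GPAdj {n : ℕ} (E : Fin n → Fin n → Set) : GPVertex n → GPVertex n → Set where
  vv : {i j : Fin n} → E i j → GPAdj E (v i) (v j)
  vx : {i : Fin n} → GPAdj E (v i) (x i)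
  xv : {i : Fin n} → GPAdj E (x i) (v i)
  xy : {i : Fin n} → GPAdj E (x i) (y i)
  yx : {i : Fin n} → GPAdj E (y i) (x i)
  yz : {i : Fin n} → GPAdj E (y i) (z i)
  zy : {i : Fin n} → GPAdj E (z i) (y i)

gpVertices : (n : ℕ) → List (GPVertex n)
gpVertices n = map v (allFin n) ++ map x (allFin n) ++ map y (allFin n) ++ map z (allFin n)

VHZ : {n : ℕ} → GPVertex n → Bool
VHZ (v _) = true
VHZ (x _) = false
VHZ (y _) = false
VHZ (z _) = true

-- A leaf of a graph lies in every restrained dominating set D, since its only
-- neighbour cannot be both in D and outside D; so every z_i is in D. If y_i ∉ D,
-- its neighbour outside D must be x_i, whose neighbour in D can then only be
-- v_i. Hence each of the n disjoint pairs {v_i, y_i} meets D, and together with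
-- the z_i this gives |D| ≥ 2n, attained by V_H ∪ {z_i}.
module Submission where

open import Defs
open import Data.Nat using (ℕ; _*_; _+_; _≤_; suc; z≤n; s≤s)
open import Data.Nat.Properties
open import Data.Fin using (Fin)
open import Data.Product using (_×_; _,_)
open import Data.Sum using (_⊎_; inj₁; inj₂)
open import Data.Bool using (Bool; true; false; if_then_else_)
open import Data.List using (List; []; _∷_; map; _++_; allFin; length)
open import Data.List.Properties using (length-tabulate)
open import Function using (_∘_)
open import Relation.Binary.PropositionalEquality

count-++ : {A : Set} (D : A → Bool) (as bs : List A) →
           count D (as ++ bs) ≡ count D as + count D bs
count-++ D []       bs = refl
count-++ D (a ∷ as) bs rewrite count-++ D as bs =
  sym (+-assoc (if D a then 1 else 0) (count D as) (count D bs))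

count-map : {A B : Set} (D : B → Bool) (f : A → B) (as : List A) →
            count D (map f as) ≡ count (D ∘ f) as
count-map D f []       = refl
count-map D f (a ∷ as) rewrite count-map D f as = refl

count-true≡length : {A : Set} (D : A → Bool) → (∀ a → D a ≡ true) →
                    (as : List A) → count D as ≡ length as
count-true≡length D all []       = refl
count-true≡length D all (a ∷ as) rewrite all a = cong suc (count-true≡length D all as)

count-false≡0 : {A : Set} (D : A → Bool) → (∀ a → D a ≡ false) →
                (as : List A) → count D as ≡ 0
count-false≡0 D none []       = refl
count-false≡0 D none (a ∷ as) rewrite none a = count-false≡0 D none as

length≤count+count : {A : Set} (D D′ : A → Bool) → (∀ a → D a ≡ true ⊎ D′ a ≡ true) →
                     (as : List A) → length as ≤ count D as + count D′ as
length≤count+count D D′ cover [] = z≤n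
length≤count+count D D′ cover (a ∷ as)
  with D a | D′ a | cover a | length≤count+count D D′ cover as
... | true  | _     | _       | ih = s≤s (≤-trans ih (+-monoʳ-≤ (count D as) (m≤n+m (count D′ as) _)))
... | false | true  | _       | ih = subst (suc (length as) ≤_) (sym (+-suc _ _)) (s≤s ih)
... | false | false | inj₁ () | _
... | false | false | inj₂ () | _

length-allFin : (n : ℕ) → length (allFin n) ≡ n
length-allFin n = length-tabulate (λ i → i)

leaf∈restrained : {V : Set} {Adj : V → V → Set} {D : V → Bool} →
                  RestrainedDominating Adj D →
                  {u w : V} → (∀ {t} → Adj u t → t ≡ w) → D u ≡ true
leaf∈restrained {D = D} restrained {u} unique with D u in Du
... | true  = refl
... | false with restrained u Du
... | (_ , ut , Dt) , (_ , ut′ , Dt′) rewrite unique ut | unique ut′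
  with () ← trans (sym Dt) Dt′

count-gpVertices : (n : ℕ) (D : GPVertex n → Bool) →
  count D (gpVertices n) ≡
    count (D ∘ v) (allFin n) + (count (D ∘ x) (allFin n) +
      (count (D ∘ y) (allFin n) + count (D ∘ z) (allFin n)))
count-gpVertices n D = begin
  count D (map v L ++ map x L ++ map y L ++ map z L)
    ≡⟨ count-++ D (map v L) _ ⟩
  count D (map v L) + count D (map x L ++ map y L ++ map z L)
    ≡⟨ cong (count D (map v L) +_) (count-++ D (map x L) _) ⟩
  count D (map v L) + (count D (map x L) + count D (map y L ++ map z L))
    ≡⟨ cong (λ c → count D (map v L) + (count D (map x L) + c)) (count-++ D (map y L) _) ⟩
  count D (map v L) + (count D (map x L) + (count D (map y L) + count D (map z L)))
    ≡⟨ cong₂ _+_ (count-map D v L) (cong₂ _+_ (count-map D x L)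
         (cong₂ _+_ (count-map D y L) (count-map D z L))) ⟩
  count (D ∘ v) L + (count (D ∘ x) L + (count (D ∘ y) L + count (D ∘ z) L)) ∎
  where
    open ≡-Reasoning
    L = allFin n

module _ {n : ℕ} {E : Fin n → Fin n → Set} {D : GPVertex n → Bool}
         (restrained : RestrainedDominating (GPAdj E) D) where

  z∈restrained : (i : Fin n) → D (z i) ≡ true
  z∈restrained i = leaf∈restrained restrained only-y
    where only-y : ∀ {t} → GPAdj E (z i) t → t ≡ y i
          only-y zy = refl

  v∈restrained⊎y∈restrained : (i : Fin n) → D (v i) ≡ true ⊎ D (y i) ≡ true
  v∈restrained⊎y∈restrained i with D (y i) in Dy
  ... | true  = inj₂ refl
  ... | false with restrained (y i) Dy
  ... | _ , (_ , yz , Dz) with () ← trans (sym (z∈restrained i)) Dz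
  ... | _ , (_ , yx , Dx) with restrained (x i) Dx
  ... | (_ , xv , Dv) , _ = inj₁ Dv
  ... | (_ , xy , Dy′) , _ with () ← trans (sym Dy′) Dy

  2n≤count-restrained : 2 * n ≤ count D (gpVertices n)
  2n≤count-restrained = begin
    2 * n                     ≡⟨ cong (n +_) (+-identityʳ n) ⟩
    n + n                     ≤⟨ +-mono-≤ vy-bound (≤-reflexive (sym z-count)) ⟩
    (cv + cy) + cz            ≡⟨ +-assoc cv cy cz ⟩
    cv + (cy + cz)            ≤⟨ +-monoʳ-≤ cv (m≤n+m (cy + cz) cx) ⟩
    cv + (cx + (cy + cz))     ≡⟨ sym (count-gpVertices n D) ⟩
    count D (gpVertices n)    ∎
    where
      open ≤-Reasoning
      L = allFin n
      cv = count (D ∘ v) L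
      cx = count (D ∘ x) L
      cy = count (D ∘ y) L
      cz = count (D ∘ z) L
      vy-bound : n ≤ cv + cy
      vy-bound = subst (_≤ cv + cy) (length-allFin n)
                   (length≤count+count (D ∘ v) (D ∘ y) v∈restrained⊎y∈restrained L)
      z-count : cz ≡ n
      z-count = trans (count-true≡length (D ∘ z) z∈restrained L) (length-allFin n)

VHZ-restrained : {n : ℕ} {E : Fin n → Fin n → Set} → RestrainedDominating (GPAdj E) VHZ
VHZ-restrained (x i) _ = (v i , xv , refl) , (y i , xy , refl)
VHZ-restrained (y i) _ = (z i , yz , refl) , (x i , yx , refl)

count-VHZ : (n : ℕ) → count VHZ (gpVertices n) ≡ 2 * n
count-VHZ n = begin
  count VHZ (gpVertices n)  ≡⟨ count-gpVertices n VHZ ⟩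
  cv + (cx + (cy + cz))     ≡⟨ cong₂ _+_ (count-true≡length (VHZ ∘ v) (λ _ → refl) L)
                               (cong₂ _+_ (count-false≡0 (VHZ ∘ x) (λ _ → refl) L)
                                 (cong₂ _+_ (count-false≡0 (VHZ ∘ y) (λ _ → refl) L)
                                   (count-true≡length (VHZ ∘ z) (λ _ → refl) L))) ⟩
  length L + length L       ≡⟨ cong₂ _+_ (length-allFin n) (length-allFin n) ⟩
  n + n                     ≡⟨ cong (n +_) (sym (+-identityʳ n)) ⟩
  2 * n                     ∎
  where
    open ≡-Reasoning
    L = allFin n
    cv = count (VHZ ∘ v) L
    cx = count (VHZ ∘ x) L
    cy = count (VHZ ∘ y) L
    cz = count (VHZ ∘ z) L

theorem4p1 : (n : ℕ) (E : Fin n → Fin n → Set) → Symmetric E → Irreflexive E →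
    IsRestrainedDomNumber (GPAdj E) (gpVertices n) (2 * n) × RestrainedDominating (GPAdj E) VHZ
theorem4p1 n E _ _ =
  ((VHZ , VHZ-restrained , count-VHZ n) , λ D restrained → 2n≤count-restrained restrained)
  , VHZ-restrained
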